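{- The approximation ratio of Algorithm 2 for the Min-WCS problem is $\Omega(n)$: there is a constant $c>0$ such that for every $n \geq 1$ there is an instance of the Min-WCS problem with $n$ job chains on which the schedule $S$ output by Algorithm 2 satisfies $wcs(S) \geq c\, n \cdot \min_{S'} wcs(S')$, the minimum being over feasible schedules.
   Context: Min-WCS problem. Input: a positive integer $n$ and job chains $\mathcal{C}_1,\dots,\mathcal{C}_n$, where $\mathcal{C}_i$ consists of $|\mathcal{C}_i|\geq 1$ jobs $J_i^1 \to \cdots \to J_i^{|\mathcal{C}_i|}$, each job $J_i^j$ having a non-negative weight $w_i^j$; $J_i^{|\mathcal{C}_i|}$ is the leaf job of $\mathcal{C}_i$. With $T=\sum_i |\mathcal{C}_i|$, a feasible schedule $S$ is a bijection from the set of all jobs to $\{1,\dots,T\}$ with $S(J_i^1)<\cdots<S(J_i^{|\mathcal{C}_i|})$ for all $i$. $wcs(S)=\sum_{i,j} w_i^j S(J_i^j)+\sum_{i} S(J_i^{|\mathcal{C}_i|})^2$. Algorithm 2: process the chains one after another, each chain entirely and contiguously in its chain order, in nondecreasing order of $|\mathcal{C}_i|$ (ties arbitrary), i.e. the schedule assigns completion times $1,2,\dots,T$ in this order. (This schedule minimizes $\sum_{i} S(J_i^{|\mathcal{C}_i|})^2$ over feasible schedules.) -}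

module Defs where

open import Data.Nat using (ℕ; zero; suc; _+_; _*_; _≤_; _<_)
open import Data.Fin using (Fin; toℕ; fromℕ; _<?_)
open import Data.Product using (Σ; _,_; proj₁; proj₂)
open import Data.Bool using (if_then_else_)
open import Relation.Nullary.Decidable using (⌊_⌋)
open import Relation.Binary.PropositionalEquality using (_≡_)
open import Function.Bundles using (_⤖_; Bijection)
open import Data.Fin.Permutation using (Permutation′; _⟨$⟩ʳ_; _⟨$⟩ˡ_)

∑ : (n : ℕ) → (Fin n → ℕ) → ℕ
∑ zero    f = 0
∑ (suc n) f = f Fin.zero + ∑ n (λ k → f (Fin.suc k))

-- Chain i has  suc (pl i)  ≥ 1 jobs
-- (pl = "predecessor of length"), job j of chain i (j : Fin (suc (pl i)),
-- 0-based, so job J_i^{j+1}) has weight  w i j  (non-negative: ℕ).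
record Instance (n : ℕ) : Set where
  field
    pl : Fin n → ℕ
    w  : (i : Fin n) → Fin (suc (pl i)) → ℕ

module _ {n : ℕ} (I : Instance n) where
  open Instance I

  len : Fin n → ℕ
  len i = suc (pl i)

  Job : Set
  Job = Σ (Fin n) (λ i → Fin (len i))

  T : ℕ
  T = ∑ n len

  leaf : (i : Fin n) → Job
  leaf i = i , fromℕ (pl i)

  wcs : (Job → ℕ) → ℕ
  wcs t = ∑ n (λ i → ∑ (len i) (λ j → w i j * t (i , j)))
        + ∑ n (λ i → t (leaf i) * t (leaf i))

  -- feasible schedule: bijection Job → {1..T} (Fin T, shifted by one)
  -- respecting the chain order
  record Schedule : Set where
    field
      S : Job ⤖ Fin T
    time : Job → ℕ
    time J = suc (toℕ (Bijection.to S J))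
    field
      chain : ∀ i (j j′ : Fin (len i)) → toℕ j < toℕ j′ →
              time (i , j) < time (i , j′)

  -- Algorithm 2: an order π of the chains (π ⟨$⟩ʳ k is the k-th processed
  -- chain), nondecreasing in chain length; ties arbitrary.
  SortedOrder : Permutation′ n → Set
  SortedOrder π = ∀ (k k′ : Fin n) → toℕ k ≤ toℕ k′ →
                  len (π ⟨$⟩ʳ k) ≤ len (π ⟨$⟩ʳ k′)

  alg2 : Permutation′ n → Job → ℕ
  alg2 π (i , j) = offset + suc (toℕ j)
    where
      pos : Fin n
      pos = π ⟨$⟩ˡ i
      offset : ℕ
      offset = ∑ n (λ k → if ⌊ k <? pos ⌋ then len (π ⟨$⟩ʳ k) else 0)

-- Take one chain of length 2 whose first job has a huge weight W, and n − 1
-- chains of length 1 with weight 0.  Algorithm 2 must run the long chain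
-- last, so the heavy job completes at time ≥ n and wcs ≥ n W.  Running the
-- long chain first completes the heavy job at time 1, and W can be chosen
-- so that the wcs of that schedule is exactly 2W.
module Submission where

open import Defs
open import Data.Nat using (ℕ; _*_; _≤_)
open import Data.Product using (Σ; _×_)
open import Data.Fin.Permutation using (Permutation′)

open import Data.Nat using (zero; suc; _+_; _<_; z≤n; s≤s; s≤s⁻¹)
open import Data.Nat.Properties
  using (≤-trans; ≤-reflexive; m≤m+n; m≤n+m; +-mono-≤; +-comm; *-monoʳ-≤;
         *-zeroʳ; *-identityʳ; +-identityʳ; module ≤-Reasoning)
open import Data.Nat.Tactic.RingSolver using (solve-∀)
open import Data.Fin using (Fin; toℕ; fromℕ; cast; _<?_)
open import Data.Fin.Properties using (toℕ-cast; cast-involutive; toℕ-fromℕ; toℕ≤pred[n])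
open import Data.Fin.Permutation using (_⟨$⟩ʳ_; _⟨$⟩ˡ_; inverseˡ; inverseʳ)
open import Data.Product using (_,_)
open import Data.Bool using (if_then_else_)
open import Relation.Nullary.Decidable using (⌊_⌋; does; isYes≗does; does-⇔)
open import Relation.Binary.PropositionalEquality
open import Function.Bundles using (mk↔ₛ′; mk⇔)
open import Function.Properties.Inverse using (↔⇒⤖)

∑-cong : ∀ n {f g : Fin n → ℕ} → (∀ k → f k ≡ g k) → ∑ n f ≡ ∑ n g
∑-cong zero    f≡g = refl
∑-cong (suc n) f≡g = cong₂ _+_ (f≡g Fin.zero) (∑-cong n (λ k → f≡g (Fin.suc k)))

∑-const : ∀ n c → ∑ n (λ _ → c) ≡ n * c
∑-const zero    c = refl
∑-const (suc n) c = cong (c +_) (∑-const n c)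

f≤∑ : ∀ n (f : Fin n → ℕ) k → f k ≤ ∑ n f
f≤∑ (suc n) f Fin.zero    = m≤m+n _ _
f≤∑ (suc n) f (Fin.suc k) = ≤-trans (f≤∑ n (λ k → f (Fin.suc k)) k) (m≤n+m _ _)

suc<?suc≡<? : ∀ {n} (k p : Fin n) → ⌊ Fin.suc k <? Fin.suc p ⌋ ≡ ⌊ k <? p ⌋
suc<?suc≡<? k p = begin
  ⌊ Fin.suc k <? Fin.suc p ⌋   ≡⟨ isYes≗does (Fin.suc k <? Fin.suc p) ⟩
  does (Fin.suc k <? Fin.suc p) ≡⟨ does-⇔ (mk⇔ s≤s⁻¹ s≤s) (Fin.suc k <? Fin.suc p) (k <? p) ⟩
  does (k <? p)                 ≡⟨ isYes≗does (k <? p) ⟨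
  ⌊ k <? p ⌋                    ∎
  where open ≡-Reasoning

toℕ≤∑-below : ∀ n (f : Fin n → ℕ) (p : Fin n) → (∀ k → 1 ≤ f k) →
              toℕ p ≤ ∑ n (λ k → if ⌊ k <? p ⌋ then f k else 0)
toℕ≤∑-below (suc n) f Fin.zero    f≥1 = z≤n
toℕ≤∑-below (suc n) f (Fin.suc p) f≥1 = +-mono-≤ (f≥1 Fin.zero) (begin
  toℕ p
    ≤⟨ toℕ≤∑-below n f′ p (λ k → f≥1 (Fin.suc k)) ⟩
  ∑ n (λ k → if ⌊ k <? p ⌋ then f′ k else 0)
    ≡⟨ ∑-cong n (λ k → cong (λ b → if b then f′ k else 0) (sym (suc<?suc≡<? k p))) ⟩
  ∑ n (λ k → if ⌊ Fin.suc k <? Fin.suc p ⌋ then f′ k else 0) ∎)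
  where
    open ≤-Reasoning
    f′ : Fin n → ℕ
    f′ k = f (Fin.suc k)

module _ {n : ℕ} (I : Instance n) where
  open Instance I

  weighted-time≤wcs : ∀ (t : Job I → ℕ) i j → w i j * t (i , j) ≤ wcs I t
  weighted-time≤wcs t i j = begin
    w i j * t (i , j)                                    ≤⟨ f≤∑ (len I i) (λ j → w i j * t (i , j)) j ⟩
    ∑ (len I i) (λ j → w i j * t (i , j))                ≤⟨ f≤∑ n (λ i → ∑ (len I i) (λ j → w i j * t (i , j))) i ⟩
    ∑ n (λ i → ∑ (len I i) (λ j → w i j * t (i , j)))   ≤⟨ m≤m+n _ _ ⟩
    wcs I t                                              ∎
    where open ≤-Reasoning

  position<alg2 : ∀ (π : Permutation′ n) i j → toℕ (π ⟨$⟩ˡ i) < alg2 I π (i , j)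
  position<alg2 π i j = ≤-trans (≤-reflexive (+-comm 1 (toℕ (π ⟨$⟩ˡ i)))) (+-mono-≤
    (toℕ≤∑-below n (λ k → len I (π ⟨$⟩ʳ k)) (π ⟨$⟩ˡ i) (λ _ → s≤s z≤n)) (s≤s z≤n))

uniquely-longest-runs-last : ∀ {m} (I : Instance (suc m)) (π : Permutation′ (suc m)) →
  SortedOrder I π → ∀ i → (∀ i′ → len I i ≤ len I i′ → i′ ≡ i) → π ⟨$⟩ˡ i ≡ fromℕ m
uniquely-longest-runs-last {m} I π sorted i longest = begin
  π ⟨$⟩ˡ i            ≡⟨ cong (π ⟨$⟩ˡ_) last≡i ⟨
  π ⟨$⟩ˡ last         ≡⟨ inverseˡ π ⟩
  fromℕ m             ∎
  where
    open ≡-Reasoning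
    last : Fin (suc m)
    last = π ⟨$⟩ʳ fromℕ m
    i≤last : len I i ≤ len I last
    i≤last = subst (λ k → len I k ≤ len I last) (inverseʳ π)
      (sorted (π ⟨$⟩ˡ i) (fromℕ m)
        (subst (toℕ (π ⟨$⟩ˡ i) ≤_) (sym (toℕ-fromℕ m)) (toℕ≤pred[n] (π ⟨$⟩ˡ i))))
    last≡i : last ≡ i
    last≡i = longest last i≤last

shortChains≡ : ∀ m → m ≡ ∑ m (λ _ → 1)
shortChains≡ m = sym (trans (∑-const m 1) (*-identityʳ m))

-- The weight of the heavy job: the sum of the squared leaf times of the
-- schedule running the long chain first.
heavyWeight : ℕ → ℕ
heavyWeight m = 2 * 2 + ∑ m (λ i → (3 + toℕ i) * (3 + toℕ i))

hardInstance : ∀ m → Instance (suc m)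
hardInstance m = record { pl = pl ; w = w }
  where
    pl : Fin (suc m) → ℕ
    pl Fin.zero    = 1
    pl (Fin.suc _) = 0
    w : ∀ i → Fin (suc (pl i)) → ℕ
    w Fin.zero    Fin.zero    = heavyWeight m
    w Fin.zero    (Fin.suc _) = 0
    w (Fin.suc _) _           = 0

module _ (m : ℕ) where
  private
    I : Instance (suc m)
    I = hardInstance m

    to : Job I → Fin (T I)
    to (Fin.zero  , Fin.zero)          = Fin.zero
    to (Fin.zero  , Fin.suc Fin.zero)  = Fin.suc Fin.zero
    to (Fin.suc i , Fin.zero)          = Fin.suc (Fin.suc (cast (shortChains≡ m) i))

    from : Fin (T I) → Job I
    from Fin.zero                = Fin.zero , Fin.zero
    from (Fin.suc Fin.zero)      = Fin.zero , Fin.suc Fin.zero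
    from (Fin.suc (Fin.suc k))   = Fin.suc (cast (sym (shortChains≡ m)) k) , Fin.zero

    to∘from : ∀ k → to (from k) ≡ k
    to∘from Fin.zero              = refl
    to∘from (Fin.suc Fin.zero)    = refl
    to∘from (Fin.suc (Fin.suc k)) =
      cong (λ k → Fin.suc (Fin.suc k)) (cast-involutive (shortChains≡ m) (sym (shortChains≡ m)) k)

    from∘to : ∀ J → from (to J) ≡ J
    from∘to (Fin.zero  , Fin.zero)         = refl
    from∘to (Fin.zero  , Fin.suc Fin.zero) = refl
    from∘to (Fin.suc i , Fin.zero)         =
      cong (λ i → Fin.suc i , Fin.zero) (cast-involutive (sym (shortChains≡ m)) (shortChains≡ m) i)

    chain-order : ∀ i (j j′ : Fin (len I i)) → toℕ j < toℕ j′ →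
                  suc (toℕ (to (i , j))) < suc (toℕ (to (i , j′)))
    chain-order Fin.zero  Fin.zero           (Fin.suc Fin.zero) _ = s≤s (s≤s z≤n)
    chain-order Fin.zero  (Fin.suc Fin.zero) (Fin.suc Fin.zero) (s≤s ())
    chain-order (Fin.suc i) Fin.zero Fin.zero ()

  longChainFirst : Schedule I
  longChainFirst = record { S = ↔⇒⤖ (mk↔ₛ′ to from to∘from from∘to) ; chain = chain-order }

  wcs-longChainFirst : wcs I (Schedule.time longChainFirst) ≡ heavyWeight m + heavyWeight m
  wcs-longChainFirst = cong₂ _+_ heavy-term leaf-terms
    where
      open ≡-Reasoning
      W : ℕ
      W = heavyWeight m
      heavy-term : W * 1 + 0 + ∑ m (λ _ → 0) ≡ W
      heavy-term = begin
        W * 1 + 0 + ∑ m (λ _ → 0)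
          ≡⟨ cong₂ (λ a b → a + 0 + b) (*-identityʳ W) (trans (∑-const m 0) (*-zeroʳ m)) ⟩
        W + 0 + 0
          ≡⟨ trans (+-identityʳ (W + 0)) (+-identityʳ W) ⟩
        W ∎
      leaf-terms : 2 * 2 + ∑ m (λ i → (3 + toℕ (cast (shortChains≡ m) i)) * (3 + toℕ (cast (shortChains≡ m) i)))
                   ≡ W
      leaf-terms = cong (2 * 2 +_)
        (∑-cong m (λ i → cong (λ t → (3 + t) * (3 + t)) (toℕ-cast (shortChains≡ m) i)))

  heavyJob-runs-last : ∀ π → SortedOrder I π → suc m ≤ alg2 I π (Fin.zero , Fin.zero)
  heavyJob-runs-last π sorted = subst (λ p → suc p ≤ alg2 I π (Fin.zero , Fin.zero)) m≡position
    (position<alg2 I π Fin.zero Fin.zero)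
    where
      onlyLong : ∀ i → 2 ≤ len I i → i ≡ Fin.zero
      onlyLong Fin.zero    _ = refl
      onlyLong (Fin.suc i) (s≤s ())
      m≡position : toℕ (π ⟨$⟩ˡ Fin.zero) ≡ m
      m≡position =
        trans (cong toℕ (uniquely-longest-runs-last I π sorted Fin.zero onlyLong)) (toℕ-fromℕ m)

m*[n+n]≡2*[n*m] : ∀ a b → a * (b + b) ≡ 2 * (b * a)
m*[n+n]≡2*[n*m] = solve-∀

alg2-within-factor : ∀ m π → SortedOrder (hardInstance m) π →
  suc m * wcs (hardInstance m) (Schedule.time (longChainFirst m))
    ≤ 2 * wcs (hardInstance m) (alg2 (hardInstance m) π)
alg2-within-factor m π sorted = begin
  suc m * wcs I (Schedule.time (longChainFirst m))   ≡⟨ cong (suc m *_) (wcs-longChainFirst m) ⟩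
  suc m * (W + W)                                    ≡⟨ m*[n+n]≡2*[n*m] (suc m) W ⟩
  2 * (W * suc m)                                    ≤⟨ *-monoʳ-≤ 2 (*-monoʳ-≤ W (heavyJob-runs-last m π sorted)) ⟩
  2 * (W * alg2 I π (Fin.zero , Fin.zero))           ≤⟨ *-monoʳ-≤ 2 (weighted-time≤wcs I (alg2 I π) Fin.zero Fin.zero) ⟩
  2 * wcs I (alg2 I π)                               ∎
  where
    open ≤-Reasoning
    I : Instance (suc m)
    I = hardInstance m
    W : ℕ
    W = heavyWeight m

proposition3 : Σ ℕ (λ k → (1 ≤ k) × ((n : ℕ) → 1 ≤ n →
                 Σ (Instance n) (λ I → (π : Permutation′ n) → SortedOrder I π →
                   Σ (Schedule I) (λ S′ →
                     n * wcs I (Schedule.time S′) ≤ k * wcs I (alg2 I π)))))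
proposition3 = 2 , s≤s z≤n , λ where
  (suc m) _ → hardInstance m , λ π sorted → longChainFirst m , alg2-within-factor m π sorted
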